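{- Let $\mathbb{F}=(W,\sqsubseteq,R,\mathsf{P})$ be a filter-descriptive possibility frame. Then every element of $\mathsf{PsAt}=\{\mathsf{ro}(\{w\})\mid w\in W\}$ is a closed element of $\mathsf{RO}(W)$, i.e.\ is the meet in $\mathsf{RO}(W)$ (equivalently, the intersection) of some subset of $\mathsf{P}$.
   Context: For a partial order $(W,\sqsubseteq)$, $\mathsf{int}(X)=\{x\mid\forall y\sqsubseteq x\,(y\in X)\}$, $\mathsf{cl}(X)=\{x\mid\exists y\sqsubseteq x\,(y\in X)\}$; $\mathsf{RO}(W)=\{X\subseteq W\mid \mathsf{int}(\mathsf{cl}(X))=X\}$ is a complete Boolean algebra whose meets are intersections (join $\mathsf{int}(\mathsf{cl}(X\cup Y))$, complement $\mathsf{int}(W\setminus X)$); $\mathsf{ro}(X)$ is the least regular open set containing $X$. For a binary relation $R$, $\Box_R(X)=\{w\mid\forall v(Rwv\Rightarrow v\in X)\}$. A possibility frame is $(W,\sqsubseteq,R,\mathsf{P})$ with $W\neq\emptyset$, $\sqsubseteq$ a partial order, $R$ a binary relation on $W$, and $\mathsf{P}\subseteq\mathsf{RO}(W)$ a Boolean subalgebra of $\mathsf{RO}(W)$ closed under $\Box_R$. It is filter-descriptive if (i) for all $w,v\in W$: if for all $X\in\mathsf{P}$ ($w\in\Box_RX\Rightarrow v\in X$) then $Rwv$; (ii) for all $w,v\in W$: if for all $X\in\mathsf{P}$ ($w\in X\Rightarrow v\in X$) then $v\sqsubseteq w$; (iii) every proper filter $F$ of the Boolean algebra $\mathsf{P}$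 equals $\{X\in\mathsf{P}\mid w\in X\}$ for some $w\in W$. An element of $\mathsf{RO}(W)$ is closed if it is a meet of elements of $\mathsf{P}$. -}

module Defs where

open import Level using (0ℓ)
import Level
open import Data.Product using (Σ; ∃; _×_; _,_)
open import Data.Empty using (⊥)
open import Relation.Nullary using (¬_)
open import Relation.Unary using (Pred; _⊆_; _∈_; _∩_; _∪_; ∅; U)
open import Relation.Binary.PropositionalEquality using (_≡_)

_≐_ : {W : Set} → Pred W 0ℓ → Pred W 0ℓ → Set
X ≐ Y = (X ⊆ Y) × (Y ⊆ X)

module _ {W : Set} (_⊑_ : W → W → Set) where
  int : Pred W 0ℓ → Pred W 0ℓ
  int X x = ∀ y → y ⊑ x → X y

  cl : Pred W 0ℓ → Pred W 0ℓ
  cl X x = ∃ λ y → (y ⊑ x) × X y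

  IsRO : Pred W 0ℓ → Set
  IsRO X = int (cl X) ≐ X

  roJoin : Pred W 0ℓ → Pred W 0ℓ → Pred W 0ℓ
  roJoin X Y = int (cl (X ∪ Y))

  roCompl : Pred W 0ℓ → Pred W 0ℓ
  roCompl X = int (λ x → ¬ X x)

  IsRoOf : Pred W 0ℓ → Pred W 0ℓ → Set₁
  IsRoOf X V = IsRO V × (X ⊆ V) × (∀ V' → IsRO V' → X ⊆ V' → V ⊆ V')

□[_] : {W : Set} → (W → W → Set) → Pred W 0ℓ → Pred W 0ℓ
□[ R ] X w = ∀ v → R w v → X v

⟦_⟧ : {W : Set} → W → Pred W 0ℓ
⟦ w ⟧ v = v ≡ w

⋂ : {W : Set} → Pred (Pred W 0ℓ) 0ℓ → Pred W (Level.suc 0ℓ)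
⋂ S x = ∀ X → S X → X x

record PossibilityFrame : Set₂ where
  field
    W      : Set
    w₀     : W                      -- W ≠ ∅
    _⊑_    : W → W → Set
    ⊑-refl  : ∀ {x} → x ⊑ x
    ⊑-trans : ∀ {x y z} → x ⊑ y → y ⊑ z → x ⊑ z
    ⊑-antisym : ∀ {x y} → x ⊑ y → y ⊑ x → x ≡ y
    R      : W → W → Set
    P      : Pred (Pred W 0ℓ) 0ℓ
    -- P is a set of subsets (respects extensional equality)
    P-ext   : ∀ {X Y} → X ≐ Y → P X → P Y
    -- P ⊆ RO(W), and P is a Boolean subalgebra of RO(W)
    P⊆RO   : ∀ {X} → P X → IsRO _⊑_ X
    P-top  : P U
    P-bot  : P ∅
    P-meet : ∀ {X Y} → P X → P Y → P (X ∩ Y)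
    P-join : ∀ {X Y} → P X → P Y → P (roJoin _⊑_ X Y)
    P-compl : ∀ {X} → P X → P (roCompl _⊑_ X)
    P-□    : ∀ {X} → P X → P (□[ R ] X)

module _ (F : PossibilityFrame) where
  open PossibilityFrame F

  record IsProperFilter (Fl : Pred (Pred W 0ℓ) 0ℓ) : Set₁ where
    field
      Fl⊆P   : ∀ {X} → Fl X → P X
      Fl-top : Fl U
      Fl-up  : ∀ {X Y} → Fl X → P Y → X ⊆ Y → Fl Y
      Fl-meet : ∀ {X Y} → Fl X → Fl Y → Fl (X ∩ Y)
      proper : ¬ Fl ∅

  record FilterDescriptive : Set₁ where
    field
      condI   : ∀ w v → (∀ X → P X → □[ R ] X w → X v) → R w v
      condII  : ∀ w v → (∀ X → P X → X w → X v) → v ⊑ w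
      condIII : ∀ Fl → IsProperFilter Fl →
              ∃ λ w → ∀ X → P X → ((Fl X → X w) × (X w → Fl X))

  IsClosed : Pred W 0ℓ → Set₁
  IsClosed V = IsRO _⊑_ V × (∃ λ (S : Pred (Pred W 0ℓ) 0ℓ) → (∀ {X} → S X → P X) × (V ⊆ ⋂ S) × (⋂ S ⊆ V))

-- ro({w}) is cut out by the P-sets containing w. Each of them is regular open
-- and contains w, so it contains ro({w}). Conversely, condition (ii) says that
-- a point lying in every such set lies below w, and regular open sets are
-- downward closed, so it lies in ro({w}).
module Submission where

open import Defs
open import Level using (0ℓ)
open import Relation.Unary using (Pred; _⊆_)
open import Data.Product using (_,_; proj₁; _×_)
open import Relation.Binary.PropositionalEquality using (refl)

module _ {W : Set} {_⊑_ : W → W → Set}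
         (⊑-trans : ∀ {x y z} → x ⊑ y → y ⊑ z → x ⊑ z) where

  IsRO⇒downClosed : ∀ {X} → IsRO _⊑_ X → ∀ {x y} → X x → y ⊑ x → X y
  IsRO⇒downClosed (intcl⊆X , X⊆intcl) Xx y⊑x =
    intcl⊆X (λ z z⊑y → X⊆intcl Xx z (⊑-trans z⊑y y⊑x))

module _ (F : PossibilityFrame) where
  open PossibilityFrame F

  neighbourhoods : W → Pred (Pred W 0ℓ) 0ℓ
  neighbourhoods w X = P X × X w

  ro-singleton⊆⋂neighbourhoods : ∀ {w V} → IsRoOf _⊑_ ⟦ w ⟧ V →
                                 V ⊆ ⋂ (neighbourhoods w)
  ro-singleton⊆⋂neighbourhoods (_ , _ , least) Vx X (PX , Xw) =
    least X (P⊆RO PX) (λ { refl → Xw }) Vx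

  ⋂neighbourhoods⊆ro : FilterDescriptive F → ∀ {w V} → IsRO _⊑_ V → V w →
                       ⋂ (neighbourhoods w) ⊆ V
  ⋂neighbourhoods⊆ro FD {w} roV Vw {x} x∈⋂ =
    IsRO⇒downClosed ⊑-trans roV Vw
      (FilterDescriptive.condII FD w x (λ X PX Xw → x∈⋂ X (PX , Xw)))

mainTheorem9 : (F : PossibilityFrame) → FilterDescriptive F →
    ∀ (w : PossibilityFrame.W F) (V : Pred (PossibilityFrame.W F) 0ℓ) →
    IsRoOf (PossibilityFrame._⊑_ F) ⟦ w ⟧ V → IsClosed F V
mainTheorem9 F FD w V roOf@(roV , w∈V , _) =
  roV , neighbourhoods F w , proj₁ ,
  ro-singleton⊆⋂neighbourhoods F roOf , ⋂neighbourhoods⊆ro F FD roV (w∈V refl)
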